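{- Let $d\ge 3$, let $S=[l_1,\dots,l_m]$ be a multiset of non-negative integers, and let $G$ be a $d$-regular graph with girth larger than $3\max(S)$, so that $G_S$ is $(a_S,b_S)$-regular. Then $b_S>0$ if and only if there is a $3\times m$ matrix, each row of which consists of the integers $l_1,\dots,l_m$ in some order, such that every column has an even sum and its three entries satisfy the triangle inequality.
   Context: With $\rho$ the graph metric of $G$, $G_S$ has vertex set $V(G)^m$, and $(x_1,\dots,x_m)\sim(y_1,\dots,y_m)$ iff $[\rho(x_1,y_1),\dots,\rho(x_m,y_m)]=S$ as multisets. $G_S$ is $a_S$-regular and each link (subgraph induced on the neighbours of a vertex) is $b_S$-regular. -}

module Defs where

open import Data.Nat using (ℕ; zero; suc; _+_; _*_; _≤_; _<_; _⊔_)
open import Data.Nat.Divisibility using (_∣_)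
open import Data.Fin using (Fin; zero; suc; inject₁; fromℕ)
open import Data.List using (List; length; foldr)
open import Data.List.Membership.Propositional using (_∈_)
open import Data.List.Relation.Unary.Unique.Propositional using (Unique)
open import Data.List.Relation.Binary.Permutation.Propositional using (_↭_)
open import Data.Vec using (Vec; lookup; toList)
open import Data.Product using (Σ; ∃; _×_; _,_)
open import Data.Empty using (⊥)
open import Function using (_⇔_)
open import Function.Definitions using (Injective)
open import Relation.Binary.PropositionalEquality using (_≡_)
open import Relation.Nullary using (¬_)

record Graph : Set₁ where
  field
    V     : Set
    Adj   : V → V → Set
    sym   : ∀ {x y} → Adj x y → Adj y x
    irrefl : ∀ {x} → ¬ Adj x x

module _ (G : Graph) where
  open Graph G

  data Walk : V → V → ℕ → Set where
    nil  : ∀ {x} → Walk x x 0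
    cons : ∀ {x y z k} → Adj x y → Walk y z k → Walk x z (suc k)

  Dist : V → V → ℕ → Set
  Dist x y k = Walk x y k × (∀ j → Walk x y j → k ≤ j)

  CycleOfLength : ℕ → Set
  CycleOfLength zero = ⊥
  CycleOfLength (suc n) =
    Σ (Fin (suc n) → V) λ f →
      Injective _≡_ _≡_ f
      × (∀ (i : Fin n) → Adj (f (inject₁ i)) (f (suc i)))
      × Adj (f (fromℕ n)) (f zero)

  -- girth(G) > g : no cycle of length at most g (cycles have length ≥ 3)
  GirthGt : ℕ → Set
  GirthGt g = ∀ k → 3 ≤ k → k ≤ g → ¬ CycleOfLength k

DegreeIs : {W : Set} → (W → W → Set) → W → ℕ → Set
DegreeIs {W} R x a =
  ∃ λ (ns : List W) → Unique ns × length ns ≡ a × (∀ y → R x y ⇔ y ∈ ns)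

RegularRel : {W : Set} → (W → W → Set) → ℕ → Set
RegularRel R a = ∀ x → DegreeIs R x a

-- every link (subgraph induced on the neighbours of x) is b-regular
LinkRegular : {W : Set} → (W → W → Set) → ℕ → Set
LinkRegular {W} R b =
  ∀ x y → R x y →
    ∃ λ (ns : List W) → Unique ns × length ns ≡ b
      × (∀ z → (R x z × R y z) ⇔ z ∈ ns)

ABRegular : {W : Set} → (W → W → Set) → ℕ → ℕ → Set
ABRegular R a b = RegularRel R a × LinkRegular R b

Regular : Graph → ℕ → Set
Regular G d = RegularRel (Graph.Adj G) d

GS-Adj : (G : Graph) (S : List ℕ) → Vec (Graph.V G) (length S) → Vec (Graph.V G) (length S) → Set
GS-Adj G S xs ys =
  ∃ λ (ds : Vec ℕ (length S)) →
    (∀ i → Dist G (lookup xs i) (lookup ys i) (lookup ds i)) × (toList ds ↭ S)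

maxL : List ℕ → ℕ
maxL = foldr _⊔_ 0

MatrixExists : List ℕ → Set
MatrixExists S =
  ∃ λ (r₁ : Vec ℕ (length S)) → ∃ λ (r₂ : Vec ℕ (length S)) → ∃ λ (r₃ : Vec ℕ (length S)) →
    (toList r₁ ↭ S) × (toList r₂ ↭ S) × (toList r₃ ↭ S)
    × (∀ i → let p = lookup r₁ i ; q = lookup r₂ i ; r = lookup r₃ i in
              (2 ∣ (p + q + r)) × (p ≤ q + r) × (q ≤ p + r) × (r ≤ p + q))

module Submission where

-- Write L = 3 · max S.  Below girth L the graph looks like a tree: a non-backtracking walk of
-- length at most L never revisits a vertex (a revisit closes a short cycle), hence it is a
-- geodesic as soon as twice its length is at most L, and a closed walk of length at most L has
-- even length (cancelling backtracks leaves a non-backtracking closed walk, which must be empty).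
-- So the coordinatewise distances of a triangle in G_S give a matrix as required: each column is
-- a triangle of distances with perimeter at most L.  Conversely an even triangle (p, q, r) with
-- half perimeter h is realised by a tripod: three non-backtracking legs of lengths h - q, h - r,
-- h - p ending at one vertex through distinct neighbours (degree at least 3).  Coordinatewise
-- this gives a triangle in G_S, i.e. a vertex in the link of an edge; in the other direction an
-- edge of G_S exists for the same reason, so a > 0 and every vertex has a neighbour.
-- Vertex equality is undecidable, so walks are built in the double-negation monad; this is
-- harmless because the goals 0 < a, 0 < b and 2 ∣ j are decidable.

open import Defs
open import Algebra.Properties.CommutativeSemigroup as CommSemigroup using ()
open import Data.Empty using (⊥-elim)
open import Data.Fin using (Fin; zero; suc; toℕ; inject₁; fromℕ)
open import Data.Fin.Properties using (toℕ-injective; toℕ<n; toℕ≤pred[n]; toℕ-inject₁; toℕ-fromℕ)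
open import Data.List using (List; []; _∷_; length)
open import Data.List.Membership.Propositional using (_∈_)
open import Data.List.Relation.Binary.Permutation.Propositional using (_↭_; ↭-reflexive)
open import Data.List.Relation.Binary.Permutation.Propositional.Properties using (∈-resp-↭)
open import Data.Vec using (Vec; lookup; toList; tabulate; fromList; replicate)
open import Data.Vec.Membership.Propositional.Properties using (∈-lookup; ∈-toList⁺)
open import Data.Vec.Properties using (lookup∘tabulate; toList∘fromList)
open import Data.List.Relation.Unary.Unique.Propositional using (Unique)
open import Data.List.Relation.Unary.All as All using ()
open import Data.List.Relation.Unary.AllPairs as AllPairs using ()
open import Data.List.Relation.Unary.Any using (here; there)
open import Data.Nat using (ℕ; zero; suc; _+_; _*_; _∸_; _≤_; _<_; z≤n; s≤s; >-nonZero; _≤?_; _<?_)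
open import Data.Nat.Divisibility using (_∣_; divides; _∣?_)
open import Data.Nat.Properties
open import Data.Product using (∃; ∃₂; _×_; _,_; proj₁; proj₂)
open import Data.Sum using (inj₁; inj₂)
open import Effect.Monad using (RawMonad)
open import Level using (0ℓ)
open import Function using (_∘_; _⇔_; case_of_)
open import Function.Bundles using (Equivalence; mk⇔)
open import Function.Definitions using (Injective)
open import Relation.Binary.PropositionalEquality
open import Relation.Nullary using (¬_; yes; no)
open import Relation.Nullary.Decidable using (¬¬-excluded-middle; decidable-stable)
open import Relation.Nullary.Negation using (¬¬-Monad; ¬¬-map)

open RawMonad (¬¬-Monad {0ℓ}) using (pure; _>>=_)
open CommSemigroup +-commutativeSemigroup
  using (interchange; xy∙z≈y∙xz; xy∙z≈yz∙x; xy∙z≈zx∙y; xy∙z≈yx∙z)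

¬¬-Π-Fin : ∀ n {P : Fin n → Set} → (∀ i → ¬ ¬ P i) → ¬ ¬ (∀ i → P i)
¬¬-Π-Fin zero _ = pure λ ()
¬¬-Π-Fin (suc n) f = do
  p₀ ← f zero
  ps ← ¬¬-Π-Fin n (f ∘ suc)
  pure λ { zero → p₀ ; (suc i) → ps i }

EvenTriangle : ℕ → ℕ → ℕ → Set
EvenTriangle p q r = 2 ∣ (p + q + r) × (p ≤ q + r) × (q ≤ p + r) × (r ≤ p + q)

≤-half : ∀ {x s h} → x ≤ s → x + s ≡ h + h → x ≤ h
≤-half x≤s eq =
  ≮⇒≥ λ h<x → <⇒≱ (+-mono-< h<x h<x) (≤-trans (+-monoʳ-≤ _ x≤s) (≤-reflexive eq))

∸-half-sum : ∀ {x y z h} → x ≤ h → y ≤ h → x + y + z ≡ h + h → (h ∸ x) + (h ∸ y) ≡ z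
∸-half-sum {x} {y} {z} {h} x≤h y≤h eq = +-cancelʳ-≡ (x + y) _ _ (begin
  (h ∸ x) + (h ∸ y) + (x + y)  ≡⟨ interchange (h ∸ x) (h ∸ y) x y ⟩
  (h ∸ x + x) + (h ∸ y + y)    ≡⟨ cong₂ _+_ (m∸n+n≡m x≤h) (m∸n+n≡m y≤h) ⟩
  h + h                        ≡⟨ sym eq ⟩
  x + y + z                    ≡⟨ +-comm (x + y) z ⟩
  z + (x + y)                  ∎)
  where open ≡-Reasoning

EvenTriangle-legs : ∀ {p q r} → EvenTriangle p q r →
  ∃₂ λ α β → ∃ λ γ → (α + β ≡ p) × (β + γ ≡ q) × (α + γ ≡ r)
EvenTriangle-legs {p} {q} {r} (divides h p+q+r≡h*2 , p≤q+r , q≤p+r , r≤p+q) =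
  h ∸ q , h ∸ r , h ∸ p ,
  ∸-half-sum q≤h r≤h (trans (sym (xy∙z≈yz∙x p q r)) sum) ,
  ∸-half-sum r≤h p≤h (trans (sym (xy∙z≈zx∙y p q r)) sum) ,
  ∸-half-sum q≤h p≤h (trans (sym (xy∙z≈yx∙z p q r)) sum)
  where
  sum : p + q + r ≡ h + h
  sum = trans p+q+r≡h*2 (trans (*-suc h 1) (cong (h +_) (*-identityʳ h)))
  p≤h : p ≤ h
  p≤h = ≤-half p≤q+r (trans (sym (+-assoc p q r)) sum)
  q≤h : q ≤ h
  q≤h = ≤-half q≤p+r (trans (sym (xy∙z≈y∙xz p q r)) sum)
  r≤h : r ≤ h
  r≤h = ≤-half r≤p+q (trans (+-comm r (p + q)) sum)

-- DegreeIs and the condition in LinkRegular are instances of HasExactly.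
HasExactly : {A : Set} → (A → Set) → ℕ → Set
HasExactly {A} P n = ∃ λ (xs : List A) → Unique xs × length xs ≡ n × (∀ x → P x ⇔ x ∈ xs)

module _ {A : Set} {P : A → Set} where

  HasExactly-pos : ∀ {n} x → HasExactly P n → P x → 0 < n
  HasExactly-pos _ (_ ∷ _ , _ , refl , _) _ = s≤s z≤n
  HasExactly-pos x ([] , _ , refl , P⇔∈) px with () ← Equivalence.to (P⇔∈ x) px

  HasExactly-witness : ∀ {n} → HasExactly P n → 0 < n → ∃ P
  HasExactly-witness (x ∷ _ , _ , _ , P⇔∈) _ = x , Equivalence.from (P⇔∈ x) (here refl)
  HasExactly-witness ([] , _ , refl , _) ()

  HasExactly-three : ∀ {n} → HasExactly P n → 3 ≤ n →
    ∃₂ λ x y → ∃ λ z → P x × P y × P z × x ≢ y × x ≢ z × y ≢ z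
  HasExactly-three
    (xs@(x ∷ y ∷ z ∷ _) , (x≢y All.∷ x≢z All.∷ _) AllPairs.∷ (y≢z All.∷ _) AllPairs.∷ _ , _ , P⇔∈) _ =
    x , y , z , from x (here refl) , from y (there (here refl)) , from z (there (there (here refl))) ,
    x≢y , x≢z , y≢z
    where
    from : ∀ w → w ∈ xs → P w
    from w = Equivalence.from (P⇔∈ w)
  HasExactly-three ([] , _ , refl , _) ()
  HasExactly-three (_ ∷ [] , _ , refl , _) (s≤s ())
  HasExactly-three (_ ∷ _ ∷ [] , _ , refl , _) (s≤s (s≤s ()))

module Walks (G : Graph) where
  open Graph G renaming (sym to Adj-sym)

  _++ʷ_ : ∀ {x y z j k} → Walk G x y j → Walk G y z k → Walk G x z (j + k)
  nil ++ʷ v = v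
  cons e u ++ʷ v = cons e (u ++ʷ v)

  snocʷ : ∀ {x y z k} → Walk G x y k → Adj y z → Walk G x z (suc k)
  snocʷ nil e = cons e nil
  snocʷ (cons e′ u) e = cons e′ (snocʷ u e)

  reverseʷ : ∀ {x y k} → Walk G x y k → Walk G y x k
  reverseʷ nil = nil
  reverseʷ (cons e u) = snocʷ (reverseʷ u) (Adj-sym e)

  zero-walk⇒≡ : ∀ {x y} → Walk G x y 0 → x ≡ y
  zero-walk⇒≡ nil = refl

  record Triangle (p q r : ℕ) : Set where
    field
      {x y z} : V
      xy : Dist G x y p
      yz : Dist G y z q
      xz : Dist G x z r

  Seq : Set
  Seq = ℕ → V

  _◃_ : V → Seq → Seq
  (x ◃ w) zero = x
  (x ◃ w) (suc i) = w i

  reverseSeq : ℕ → Seq → Seq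
  reverseSeq k w i = w (k ∸ i)

  join : ℕ → Seq → Seq → Seq
  join zero s t = t
  join (suc a) s t = s 0 ◃ join a (s ∘ suc) t

  join-head : ∀ a {s t} → s a ≡ t 0 → join a s t 0 ≡ s 0
  join-head zero e = sym e
  join-head (suc a) e = refl

  join-last : ∀ a {s t i} → join a s t (a + i) ≡ t i
  join-last zero = refl
  join-last (suc a) = join-last a

  record IsNBWalk (w : Seq) (k : ℕ) : Set where
    field
      adjacent : ∀ {i} → i < k → Adj (w i) (w (suc i))
      noBacktrack : ∀ {i} → 2 + i ≤ k → w i ≢ w (2 + i)
  open IsNBWalk public

  NB-≤ : ∀ {w k k′} → k ≤ k′ → IsNBWalk w k′ → IsNBWalk w k
  NB-≤ k≤k′ nb = record
    { adjacent = λ i<k → adjacent nb (≤-trans i<k k≤k′)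
    ; noBacktrack = λ 2+i≤k → noBacktrack nb (≤-trans 2+i≤k k≤k′) }

  NB-tail : ∀ {w k} → IsNBWalk w (suc k) → IsNBWalk (w ∘ suc) k
  NB-tail nb = record
    { adjacent = λ i<k → adjacent nb (s≤s i<k)
    ; noBacktrack = λ 2+i≤k → noBacktrack nb (s≤s 2+i≤k) }

  NB-◃ : ∀ {x w k} → Adj x (w 0) → (0 < k → x ≢ w 1) → IsNBWalk w k → IsNBWalk (x ◃ w) (suc k)
  NB-◃ {x} {w} {k} x~w₀ x≢w₁ nb = record { adjacent = adj ; noBacktrack = nbk }
    where
    adj : ∀ {i} → i < suc k → Adj ((x ◃ w) i) ((x ◃ w) (suc i))
    adj {zero} _ = x~w₀
    adj {suc i} (s≤s i<k) = adjacent nb i<k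
    nbk : ∀ {i} → 2 + i ≤ suc k → (x ◃ w) i ≢ (x ◃ w) (2 + i)
    nbk {zero} (s≤s 0<k) = x≢w₁ 0<k
    nbk {suc i} (s≤s 2+i≤k) = noBacktrack nb 2+i≤k

  NB-0 : ∀ {w} → IsNBWalk w 0
  NB-0 = record { adjacent = λ () ; noBacktrack = λ () }

  walkOf : ∀ k {w} → IsNBWalk w k → Walk G (w 0) (w k) k
  walkOf zero _ = nil
  walkOf (suc k) nb = cons (adjacent nb (s≤s z≤n)) (walkOf k (NB-tail nb))

  private
    ∸-suc : ∀ {k i} → suc i ≤ k → k ∸ i ≡ suc (k ∸ suc i)
    ∸-suc {suc k} {zero} _ = refl
    ∸-suc {suc k} {suc i} (s≤s i<k) = ∸-suc i<k

    ∸-2+ : ∀ {k i} → 2 + i ≤ k → k ∸ i ≡ 2 + (k ∸ (2 + i))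
    ∸-2+ 2+i≤k = trans (∸-suc (≤-trans (n≤1+n _) 2+i≤k)) (cong suc (∸-suc 2+i≤k))

  NB-reverse : ∀ {w k} → IsNBWalk w k → IsNBWalk (reverseSeq k w) k
  NB-reverse {w} {k} nb = record { adjacent = adj ; noBacktrack = nbk }
    where
    adj : ∀ {i} → i < k → Adj (w (k ∸ i)) (w (k ∸ suc i))
    adj {i} i<k rewrite ∸-suc i<k =
      Adj-sym (adjacent nb (subst (_≤ k) (∸-suc i<k) (m∸n≤m k i)))
    nbk : ∀ {i} → 2 + i ≤ k → w (k ∸ i) ≢ w (k ∸ (2 + i))
    nbk {i} 2+i≤k rewrite ∸-2+ 2+i≤k = noBacktrack nb (subst (_≤ k) (∸-2+ 2+i≤k) (m∸n≤m k i)) ∘ sym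

  -- join a s t does not backtrack at the vertex s a = t 0.
  Junction : ℕ → ℕ → Seq → Seq → Set
  Junction a b s t = ∀ {a′ b′} → a ≡ suc a′ → b ≡ suc b′ → s a′ ≢ t 1

  NB-join : ∀ a {b s t} → s a ≡ t 0 → Junction a b s t →
            IsNBWalk s a → IsNBWalk t b → IsNBWalk (join a s t) (a + b)
  NB-join zero _ _ _ nbt = nbt
  NB-join (suc a) {b} {s} {t} e J nbs nbt =
    NB-◃ (subst (Adj (s 0)) (sym (join-head a e)) (adjacent nbs (s≤s z≤n)))
         (turn a e J nbs)
         (NB-join a e (J ∘ cong suc) (NB-tail nbs) nbt)
    where
    turn : ∀ a {s} → s (suc a) ≡ t 0 → Junction (suc a) b s t → IsNBWalk s (suc a) →
           0 < a + b → s 0 ≢ join a (s ∘ suc) t 1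
    turn zero _ J _ 0<b = J refl (sym (suc-pred b {{>-nonZero 0<b}}))
    turn (suc a) {s} e _ nbs _ = subst (s 0 ≢_) (sym (join-head a e)) (noBacktrack nbs (s≤s (s≤s z≤n)))

module TreeLike (G : Graph) {L : ℕ} (girth : GirthGt G L) where
  open Graph G renaming (sym to Adj-sym)
  open Walks G

  InjectiveUpTo : Seq → ℕ → Set
  InjectiveUpTo w n = ∀ {i j} → i ≤ n → j ≤ n → w i ≡ w j → i ≡ j

  cycle : ∀ m i {w} → InjectiveUpTo w (m + i) → IsNBWalk w (m + i) → Adj (w (m + i)) (w i) →
          CycleOfLength G (suc m)
  cycle m i {w} inj nb closing = f , f-injective , f-adjacent , f-closing
    where
    f : Fin (suc m) → V
    f k = w (toℕ k + i)
    f-injective : Injective _≡_ _≡_ f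
    f-injective {k} {l} eq = toℕ-injective (+-cancelʳ-≡ i _ _
      (inj (+-monoˡ-≤ i (toℕ≤pred[n] k)) (+-monoˡ-≤ i (toℕ≤pred[n] l)) eq))
    f-adjacent : ∀ k → Adj (f (inject₁ k)) (f (suc k))
    f-adjacent k rewrite toℕ-inject₁ k = adjacent nb (+-monoˡ-≤ i (toℕ<n k))
    f-closing : Adj (f (fromℕ m)) (f zero)
    f-closing rewrite toℕ-fromℕ m = closing

  no-return : ∀ m i {w} → suc (m + i) ≤ L → InjectiveUpTo w (m + i) → IsNBWalk w (suc (m + i)) →
              w i ≢ w (suc (m + i))
  no-return zero i {w} _ _ nb eq = irrefl (subst (λ v → Adj v (w (suc i))) eq (adjacent nb ≤-refl))
  no-return (suc zero) _ _ _ nb = noBacktrack nb ≤-refl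
  no-return (suc (suc m)) i le inj nb eq =
    girth (3 + m) (s≤s (s≤s (s≤s z≤n))) (≤-trans (m≤m+n (3 + m) i) le)
      (cycle (2 + m) i inj (NB-≤ (n≤1+n _) nb) (subst (Adj _) (sym eq) (adjacent nb ≤-refl)))

  InjectiveUpTo-suc : ∀ {w n} → InjectiveUpTo w n → (∀ {i} → i ≤ n → w i ≢ w (suc n)) →
                      InjectiveUpTo w (suc n)
  InjectiveUpTo-suc inj fresh p q eq with m≤n⇒m<n∨m≡n p | m≤n⇒m<n∨m≡n q
  ... | inj₁ (s≤s i≤n) | inj₁ (s≤s j≤n) = inj i≤n j≤n eq
  ... | inj₂ refl      | inj₂ refl      = refl
  ... | inj₁ (s≤s i≤n) | inj₂ refl      = ⊥-elim (fresh i≤n eq)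
  ... | inj₂ refl      | inj₁ (s≤s j≤n) = ⊥-elim (fresh j≤n (sym eq))

  nb-fresh : ∀ {n i w} → i ≤ n → suc n ≤ L → InjectiveUpTo w n → IsNBWalk w (suc n) → w i ≢ w (suc n)
  nb-fresh {n} {i} i≤n with n ∸ i | m∸n+n≡m i≤n
  ... | m | refl = no-return m i

  nb-injective : ∀ n {w} → n ≤ L → IsNBWalk w n → InjectiveUpTo w n
  nb-injective zero _ _ z≤n z≤n _ = refl
  nb-injective (suc n) {w} le nb = InjectiveUpTo-suc inj (λ i≤n → nb-fresh i≤n le inj nb)
    where
    inj : InjectiveUpTo w n
    inj = nb-injective n (≤-trans (n≤1+n n) le) (NB-≤ (n≤1+n n) nb)

  nb-not-closed : ∀ n {w} → suc n ≤ L → IsNBWalk w (suc n) → w 0 ≢ w (suc n)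
  nb-not-closed n le nb eq with () ← nb-injective (suc n) le nb z≤n ≤-refl eq

  -- Peeling the first step off the competing walk either follows w or extends w backwards.
  nb-shortest : ∀ j k {w} → k + j ≤ L → IsNBWalk w k → Walk G (w 0) (w k) j → k ≤ j
  nb-shortest _ zero _ _ _ = z≤n
  nb-shortest zero (suc k) le nb u =
    ⊥-elim (nb-not-closed k (subst (_≤ L) (+-identityʳ _) le) nb (zero-walk⇒≡ u))
  nb-shortest (suc j) (suc k) {w} le nb (cons {y = y} w₀~y u) = decidable-stable (suc k ≤? suc j) do
    y≟w₁ ← ¬¬-excluded-middle
    pure (case y≟w₁ of λ
      { (yes y≡w₁) → s≤s (nb-shortest j k (≤-trans (+-mono-≤ (n≤1+n k) (n≤1+n j)) le) (NB-tail nb)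
                           (subst (λ v → Walk G v (w (suc k)) j) y≡w₁ u))
      ; (no y≢w₁) → <⇒≤ (m≤n⇒m≤1+n (nb-shortest j (2 + k) (subst (_≤ L) (+-suc (suc k) j) le)
                           (NB-◃ (Adj-sym w₀~y) (λ _ → y≢w₁) nb) u)) })

  nb-geodesic : ∀ k {w} → k + k ≤ L → IsNBWalk w k → Dist G (w 0) (w k) k
  nb-geodesic k {w} le nb = walkOf k nb , shortest
    where
    shortest : ∀ j → Walk G (w 0) (w k) j → k ≤ j
    shortest j u with ≤-total k j
    ... | inj₁ k≤j = k≤j
    ... | inj₂ j≤k = nb-shortest j k (≤-trans (+-monoʳ-≤ k j≤k) le) nb u

  record Reduced (x z : V) (j : ℕ) : Set where
    constructor reduced
    field
      m t : ℕ
      {s} : Seq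
      length≡ : j ≡ m + t * 2
      nbWalk : IsNBWalk s m
      start : s 0 ≡ x
      end : s m ≡ z

  reduce-cons : ∀ {x y z j} → Adj x y → Reduced y z j → ¬ ¬ Reduced x z (suc j)
  reduce-cons {x} x~y (reduced zero t eq nb refl end) =
    pure (reduced 1 t (cong suc eq) (NB-◃ x~y (λ ()) nb) refl end)
  reduce-cons {x} x~y (reduced (suc m) t {s} eq nb refl end) = do
    x≟s₁ ← ¬¬-excluded-middle
    pure (case x≟s₁ of λ
      { (yes x≡s₁) → reduced m (suc t) (trans (cong suc eq) (backtrack m t)) (NB-tail nb) (sym x≡s₁) end
      ; (no x≢s₁) → reduced (2 + m) t (cong suc eq) (NB-◃ x~y (λ _ → x≢s₁) nb) refl end })
    where
    backtrack : ∀ m t → 2 + (m + t * 2) ≡ m + suc t * 2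
    backtrack m t = sym (trans (+-suc m _) (cong suc (+-suc m _)))

  reduce : ∀ {x z j} → Walk G x z j → ¬ ¬ Reduced x z j
  reduce {x} nil = pure (reduced 0 0 {λ _ → x} refl NB-0 refl refl)
  reduce (cons x~y u) = reduce u >>= reduce-cons x~y

  closed-walk-even : ∀ {x j} → j ≤ L → Walk G x x j → 2 ∣ j
  closed-walk-even {j = j} j≤L u = decidable-stable (2 ∣? j) (¬¬-map even (reduce u))
    where
    even : Reduced _ _ j → 2 ∣ j
    even (reduced zero t eq _ _ _) = divides t eq
    even (reduced (suc m) t eq nb refl end) =
      ⊥-elim (nb-not-closed m (≤-trans (subst (suc m ≤_) (sym eq) (m≤m+n (suc m) (t * 2))) j≤L) nb (sym end))

  even-triangle : ∀ {x y z p q r} → p + q + r ≤ L →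
                  Dist G x y p → Dist G y z q → Dist G x z r → EvenTriangle p q r
  even-triangle {p = p} {q} {r} le (xy , xy-shortest) (yz , yz-shortest) (xz , xz-shortest) =
    closed-walk-even le ((xy ++ʷ yz) ++ʷ reverseʷ xz) ,
    subst (p ≤_) (+-comm r q) (xy-shortest _ (xz ++ʷ reverseʷ yz)) ,
    yz-shortest _ (reverseʷ xy ++ʷ xz) ,
    xz-shortest _ (xy ++ʷ yz)

  module Branching {d : ℕ} (regular : Regular G d) (3≤d : 3 ≤ d) where

    ¬¬-neighbour-avoiding : ∀ v u → ¬ ¬ ∃ λ y → Adj v y × y ≢ u
    ¬¬-neighbour-avoiding v u with HasExactly-three (regular v) 3≤d
    ... | n₁ , n₂ , _ , v~n₁ , v~n₂ , _ , n₁≢n₂ , _ = do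
      n₁≟u ← ¬¬-excluded-middle
      pure (case n₁≟u of λ
        { (yes n₁≡u) → n₂ , v~n₂ , λ n₂≡u → n₁≢n₂ (trans n₁≡u (sym n₂≡u))
        ; (no n₁≢u) → n₁ , v~n₁ , n₁≢u })

    record Leg (c n : V) (k : ℕ) : Set where
      field
        {s} : Seq
        nbWalk : IsNBWalk s k
        end : s k ≡ c
        via : ∀ {k′} → k ≡ suc k′ → s k′ ≡ n

    ¬¬-leg : ∀ {c n} → Adj n c → ∀ k → ¬ ¬ Leg c n k
    ¬¬-leg {c} _ zero = pure (record { s = λ _ → c ; nbWalk = NB-0 ; end = refl ; via = λ () })
    ¬¬-leg {c} {n} n~c (suc zero) =
      pure (record { s = n ◃ (λ _ → c) ; nbWalk = NB-◃ n~c (λ ()) NB-0 ; end = refl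
                   ; via = λ { refl → refl } })
    ¬¬-leg n~c (suc (suc k)) = do
      record { s = s ; nbWalk = nb ; end = end ; via = via } ← ¬¬-leg n~c (suc k)
      y , s₀~y , y≢s₁ ← ¬¬-neighbour-avoiding (s 0) (s 1)
      pure (record { s = y ◃ s ; nbWalk = NB-◃ (Adj-sym s₀~y) (λ _ → y≢s₁) nb ; end = end
                   ; via = λ { refl → via refl } })
    open Leg

    legs-junction : ∀ a b {c n₁ n₂} (ℓ₁ : Leg c n₁ a) (ℓ₂ : Leg c n₂ b) → n₁ ≢ n₂ →
                    Junction a b (s ℓ₁) (reverseSeq b (s ℓ₂))
    legs-junction (suc a) (suc b) ℓ₁ ℓ₂ n₁≢n₂ refl refl eq =
      n₁≢n₂ (trans (sym (via ℓ₁ refl)) (trans eq (via ℓ₂ refl)))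

    legs-geodesic : ∀ {c n₁ n₂ a b} → (a + b) + (a + b) ≤ L → n₁ ≢ n₂ →
                    (ℓ₁ : Leg c n₁ a) (ℓ₂ : Leg c n₂ b) → Dist G (s ℓ₁ 0) (s ℓ₂ 0) (a + b)
    legs-geodesic {a = a} {b} le n₁≢n₂ ℓ₁ ℓ₂ =
      subst₂ (λ x y → Dist G x y (a + b)) (join-head a meet) (trans (join-last a) (cong (s ℓ₂) (n∸n≡0 b)))
        (nb-geodesic (a + b) le
          (NB-join a meet (legs-junction a b ℓ₁ ℓ₂ n₁≢n₂) (nbWalk ℓ₁) (NB-reverse (nbWalk ℓ₂))))
      where
      meet : s ℓ₁ a ≡ s ℓ₂ b
      meet = trans (end ℓ₁) (sym (end ℓ₂))

    ¬¬-triangle : ∀ (c : V) {p q r} → p + p ≤ L → q + q ≤ L → r + r ≤ L →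
                  EvenTriangle p q r → ¬ ¬ Triangle p q r
    ¬¬-triangle c lp lq lr even with EvenTriangle-legs even | HasExactly-three (regular c) 3≤d
    ... | α , β , γ , refl , refl , refl
        | n₁ , n₂ , n₃ , c~n₁ , c~n₂ , c~n₃ , n₁≢n₂ , n₁≢n₃ , n₂≢n₃ = do
      ℓ₁ ← ¬¬-leg (Adj-sym c~n₁) α
      ℓ₂ ← ¬¬-leg (Adj-sym c~n₂) β
      ℓ₃ ← ¬¬-leg (Adj-sym c~n₃) γ
      pure (record { xy = legs-geodesic lp n₁≢n₂ ℓ₁ ℓ₂
                   ; yz = legs-geodesic lq n₂≢n₃ ℓ₂ ℓ₃
                   ; xz = legs-geodesic lr n₁≢n₃ ℓ₁ ℓ₃ })

    ¬¬-geodesic : ∀ (c : V) k → k + k ≤ L → ¬ ¬ ∃₂ λ x y → Dist G x y k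
    ¬¬-geodesic c k le with HasExactly-witness (regular c) (≤-trans (s≤s z≤n) 3≤d)
    ... | n , c~n = do
      ℓ ← ¬¬-leg (Adj-sym c~n) k
      pure (s ℓ 0 , s ℓ k , nb-geodesic k le (nbWalk ℓ))

∈⇒≤maxL : ∀ {x xs} → x ∈ xs → x ≤ maxL xs
∈⇒≤maxL {xs = y ∷ xs} (here refl) = m≤m⊔n y (maxL xs)
∈⇒≤maxL {xs = y ∷ xs} (there x∈xs) = m≤n⇒m≤o⊔n y (∈⇒≤maxL x∈xs)

lookup≤maxL : ∀ {S} (r : Vec ℕ (length S)) → toList r ↭ S → ∀ i → lookup r i ≤ maxL S
lookup≤maxL r r↭S i = ∈⇒≤maxL (∈-resp-↭ r↭S (∈-toList⁺ (∈-lookup i r)))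

double≤3* : ∀ {x M} → x ≤ M → x + x ≤ 3 * M
double≤3* {M = M} x≤M = +-mono-≤ x≤M (≤-trans x≤M (m≤m+n M (M + 0)))

sum≤3* : ∀ {x y z M} → x ≤ M → y ≤ M → z ≤ M → x + y + z ≤ 3 * M
sum≤3* {x} {y} {z} {M} x≤M y≤M z≤M = begin
  x + y + z      ≤⟨ +-mono-≤ (+-mono-≤ x≤M y≤M) z≤M ⟩
  M + M + M      ≡⟨ +-assoc M M M ⟩
  M + (M + M)    ≡⟨ cong (λ k → M + (M + k)) (sym (+-identityʳ M)) ⟩
  3 * M          ∎
  where open ≤-Reasoning

module DistanceGraph (G : Graph) (S : List ℕ) where
  open Graph G using (V)
  open Walks G

  GS-Adj-tabulate : ∀ (f g : Fin (length S) → V) {ds} → (∀ i → Dist G (f i) (g i) (lookup ds i)) →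
                    toList ds ↭ S → GS-Adj G S (tabulate f) (tabulate g)
  GS-Adj-tabulate f g {ds} dist ds↭S =
    ds , (λ i → subst₂ (λ x y → Dist G x y (lookup ds i))
                       (sym (lookup∘tabulate f i)) (sym (lookup∘tabulate g i)) (dist i)) , ds↭S

  GS-Triangle : (xs ys zs : Vec V (length S)) → Set
  GS-Triangle xs ys zs = GS-Adj G S xs ys × GS-Adj G S ys zs × GS-Adj G S xs zs

  module _ (girth : GirthGt G (3 * maxL S)) where
    open TreeLike G girth

    GS-Triangle⇒MatrixExists : ∀ xs ys zs → GS-Triangle xs ys zs → MatrixExists S
    GS-Triangle⇒MatrixExists _ _ _ ((r₁ , d₁ , r₁↭S) , (r₂ , d₂ , r₂↭S) , (r₃ , d₃ , r₃↭S)) =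
      r₁ , r₂ , r₃ , r₁↭S , r₂↭S , r₃↭S , λ i →
        even-triangle
          (sum≤3* (lookup≤maxL r₁ r₁↭S i) (lookup≤maxL r₂ r₂↭S i) (lookup≤maxL r₃ r₃↭S i))
          (d₁ i) (d₂ i) (d₃ i)

    module _ {d} (regular : Regular G d) (3≤d : 3 ≤ d) (c : V) where
      open Branching regular 3≤d

      ¬¬-GS-edge : ¬ ¬ ∃₂ (GS-Adj G S)
      ¬¬-GS-edge = do
        geodesics ← ¬¬-Π-Fin (length S) λ i →
          ¬¬-geodesic c (lookup ds i) (double≤3* (lookup≤maxL ds ds↭S i))
        let x = proj₁ ∘ geodesics
            y = proj₁ ∘ proj₂ ∘ geodesics
        pure (tabulate x , tabulate y , GS-Adj-tabulate x y (proj₂ ∘ proj₂ ∘ geodesics) ds↭S)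
        where
        ds : Vec ℕ (length S)
        ds = fromList S
        ds↭S : toList ds ↭ S
        ds↭S = ↭-reflexive (toList∘fromList S)

      MatrixExists⇒¬¬GS-Triangle : MatrixExists S → ¬ ¬ ∃₂ λ xs ys → ∃ (GS-Triangle xs ys)
      MatrixExists⇒¬¬GS-Triangle (r₁ , r₂ , r₃ , r₁↭S , r₂↭S , r₃↭S , columns) = do
        triangles ← ¬¬-Π-Fin (length S) λ i →
          ¬¬-triangle c (double≤3* (lookup≤maxL r₁ r₁↭S i)) (double≤3* (lookup≤maxL r₂ r₂↭S i))
                        (double≤3* (lookup≤maxL r₃ r₃↭S i)) (columns i)
        let open Triangle
            x = Triangle.x ∘ triangles
            y = Triangle.y ∘ triangles
            z = Triangle.z ∘ triangles
        pure (tabulate x , tabulate y , tabulate z ,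
              GS-Adj-tabulate x y (xy ∘ triangles) r₁↭S ,
              GS-Adj-tabulate y z (yz ∘ triangles) r₂↭S ,
              GS-Adj-tabulate x z (xz ∘ triangles) r₃↭S)

claim3p2 : (G : Graph) (d : ℕ) → 3 ≤ d → Regular G d → Graph.V G →
    (S : List ℕ) → GirthGt G (3 * maxL S) →
    (a b : ℕ) → ABRegular (GS-Adj G S) a b →
    (0 < b ⇔ MatrixExists S)
claim3p2 G d 3≤d regular c S girth a b (GS-regular , GS-linkRegular) = mk⇔ link→matrix matrix→link
  where
  open DistanceGraph G S

  0<a : 0 < a
  0<a = decidable-stable (0 <? a)
    (¬¬-map (λ (xs , ys , xs~ys) → HasExactly-pos ys (GS-regular xs) xs~ys) (¬¬-GS-edge girth regular 3≤d c))

  link→matrix : 0 < b → MatrixExists S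
  link→matrix 0<b =
    let xs = replicate (length S) c
        ys , xs~ys = HasExactly-witness (GS-regular xs) 0<a
        zs , xs~zs , ys~zs = HasExactly-witness (GS-linkRegular xs ys xs~ys) 0<b
    in GS-Triangle⇒MatrixExists girth xs ys zs (xs~ys , ys~zs , xs~zs)

  matrix→link : MatrixExists S → 0 < b
  matrix→link m = decidable-stable (0 <? b)
    (¬¬-map (λ (xs , ys , zs , xs~ys , ys~zs , xs~zs) →
               HasExactly-pos zs (GS-linkRegular xs ys xs~ys) (xs~zs , ys~zs))
            (MatrixExists⇒¬¬GS-Triangle girth regular 3≤d c m))
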